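{- Let $G$ be a graph with a fixed vertex $r$ and let $k\in\mathbb N$. Then the set $\Omega_k$ of those ends of $G$ that are dominated by some vertex in $B_k(r)$ is closed in $\Omega(G)$.
   Context: Graphs may be infinite. Ends are equivalence classes of rays, two rays being equivalent if for every finite vertex set $S$ they have tails in the same component of $G-S$; $\Omega(G)$ is the set of ends, topologised by the basic open sets $\{\omega : \omega \text{ lives in } C\}$ for $S$ a finite vertex set and $C$ a component of $G-S$ (an end lives in $C$ if its rays have tails in $C$). A vertex $v$ dominates an end $\omega$ if there are infinitely many paths from $v$ to some ray of $\omega$ pairwise meeting only in $v$. $B_k(r)$ is the set of vertices at distance at most $k$ from $r$. -}

module Defs where

open import Level using (0ℓ)
open import Data.Nat using (ℕ; zero; suc; _≤_)
open import Data.Product using (Σ; ∃; _×_; _,_)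
open import Data.List using (List; []; _∷_)
open import Data.List.Membership.Propositional using (_∈_; _∉_)
open import Data.List.Relation.Unary.Unique.Propositional using (Unique)
open import Relation.Binary.PropositionalEquality using (_≡_; _≢_)
open import Relation.Nullary using (¬_)
open import Data.Empty using (⊥)

record Graph : Set₁ where
  field
    V      : Set
    _~_    : V → V → Set
    ~-sym  : ∀ {u v} → u ~ v → v ~ u
    ~-irr  : ∀ {v} → ¬ (v ~ v)

module _ (G : Graph) where
  open Graph G

  data WalkIn (P : V → Set) : V → V → Set where
    stop : ∀ {u} → P u → WalkIn P u u
    step : ∀ {u w v} → P u → u ~ w → WalkIn P w v → WalkIn P u v

  data Walk : ℕ → V → V → Set where
    stop : ∀ {u} → Walk zero u u
    step : ∀ {n u w v} → u ~ w → Walk n w v → Walk (suc n) u v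

  InBall : ℕ → V → V → Set
  InBall k r v = Σ ℕ λ n → n ≤ k × Walk n r v

  Outside : List V → V → Set
  Outside S v = v ∉ S

  -- v lies in the component of G - S containing c (c ∉ S).
  InComp : List V → V → V → Set
  InComp S c v = WalkIn (Outside S) c v

  record Ray : Set where
    field
      seq  : ℕ → V
      inj  : ∀ {m n} → seq m ≡ seq n → m ≡ n
      adj  : ∀ n → seq n ~ seq (suc n)
  open Ray public

  LivesIn : List V → V → Ray → Set
  LivesIn S c R = Σ ℕ λ m → ∀ n → m ≤ n → InComp S c (seq R n)

  -- Equivalence of rays (ends are the equivalence classes).
  RayEquiv : Ray → Ray → Set
  RayEquiv R R' = ∀ (S : List V) → Σ V λ c → c ∉ S × LivesIn S c R × LivesIn S c R'

  data PathFrom : V → List V → Set where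
    one  : ∀ {v} → PathFrom v (v ∷ [])
    cons : ∀ {u w p} → u ~ w → PathFrom w p → PathFrom u (u ∷ p)

  Last : List V → V → Set
  Last []           x = ⊥
  Last (y ∷ [])     x = y ≡ x
  Last (y ∷ z ∷ zs) x = Last (z ∷ zs) x

  PathToRay : V → Ray → List V → Set
  PathToRay v R p = PathFrom v p × Unique p × Σ V λ x → Last p x × Σ ℕ λ n → seq R n ≡ x

  -- v dominates the end of R: infinitely many (distinct) paths from v to some
  -- ray of that end, pairwise meeting only in v.
  Dominates : V → Ray → Set
  Dominates v R = Σ Ray λ R' → RayEquiv R R' ×
    Σ (ℕ → List V) λ P →
      (∀ i → PathToRay v R' (P i)) ×
      (∀ i j → i ≢ j → P i ≢ P j) ×
      (∀ i j → i ≢ j → ∀ x → x ∈ P i → x ∈ P j → x ≡ v)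

  InΩ : V → ℕ → Ray → Set
  InΩ r k R = Σ V λ v → InBall k r v × Dominates v R

  -- A set of ends (given by a predicate on rays, invariant under RayEquiv) is closed:
  -- its complement is open, i.e. every end outside it has a basic open neighbourhood
  -- (ends living in a component C of G - S, S finite) disjoint from it.
  IsClosed : (Ray → Set) → Set
  IsClosed X = ∀ (R : Ray) → ¬ X R →
    Σ (List V) λ S → Σ V λ c → c ∉ S × LivesIn S c R ×
      (∀ (R' : Ray) → LivesIn S c R' → ¬ X R')

module Submission where

-- The proof rests on a characterisation of domination by separation:
-- v dominates the end of a ray R iff no finite S ∌ v separates v from R
-- (v is "unseparated" from R).  One direction reroutes two of the
-- infinitely many dominating paths around S; the other builds the
-- dominating paths greedily, each avoiding all earlier ones except at v.
--
-- Given R outside Ω_k, we show by strong induction on b that every ball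
-- B_b(u) free of dominators of R is "shielded" by a finite S: no ray
-- sharing a component of G - S with R is dominated from B_b(u).  For the
-- step, u itself is separated from R by some S₀; a walk from u of length
-- ≤ b either stays outside S₀ (then the last vertex cannot dominate a ray
-- near R) or first meets S₀ at y, leaving a shorter walk from y, which is
-- handled by the shields of the smaller balls around the vertices of S₀.
-- The case b = k, u = r gives the basic open neighbourhood of R avoiding Ω_k.
--
-- Excluded middle is used for decidable equality of vertices, for locating
-- where rays and paths meet a finite set, and for the classical
-- contrapositive of the greedy construction.

open import Defs
open import Level using (0ℓ)
open import Data.Nat using (ℕ; zero; suc; _+_; _⊔_; _≤_; _<_; _≤′_; ≤′-refl; ≤′-step; z≤n; s≤s)
open import Data.Nat.Properties hiding (_≟_)
open import Data.Nat.Induction using (<-rec)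
open import Data.Product using (Σ; _×_; _,_; proj₁; proj₂)
open import Data.Sum using (_⊎_; inj₁; inj₂)
open import Data.List using (List; []; _∷_; _++_; [_]; concat; filter; applyUpTo; upTo; cartesianProduct)
open import Data.List.Membership.Propositional using (_∈_; _∉_)
open import Data.List.Membership.Propositional.Properties
  using (∈-++⁺ˡ; ∈-++⁺ʳ; ∈-concat⁺′; ∈-filter⁺; ∈-filter⁻; ∈-applyUpTo⁺; ∈-upTo⁺; ∈-cartesianProduct⁺)
open import Data.List.Relation.Binary.Subset.Propositional using (_⊆_)
open import Data.List.Relation.Binary.Subset.Propositional.Properties using (xs⊆xs++ys; xs⊆ys++xs)
open import Data.List.Relation.Unary.Any using (here; there)
open import Data.List.Relation.Unary.All using ([]; _∷_)
open import Data.List.Relation.Unary.All.Properties using (¬Any⇒All¬; All¬⇒¬Any)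
open import Data.List.Relation.Unary.AllPairs using ([]; _∷_)
open import Data.List.Relation.Unary.Unique.Propositional using (Unique)
open import Axiom.ExcludedMiddle using (ExcludedMiddle)
open import Axiom.DoubleNegationElimination using (em⇒dne)
open import Relation.Binary using (DecidableEquality; tri<; tri≈; tri>)
open import Relation.Binary.PropositionalEquality using (_≡_; _≢_; refl; sym; trans; subst)
open import Relation.Nullary using (¬_; yes; no; ¬?)
open import Data.Empty using (⊥; ⊥-elim)

Eventually : (ℕ → Set) → Set
Eventually P = Σ ℕ λ m → ∀ n → m ≤ n → P n

eventually-× : {P Q : ℕ → Set} → Eventually P → Eventually Q → Eventually (λ n → P n × Q n)
eventually-× (m , p) (m′ , q) = m ⊔ m′ , λ n le →
  p n (≤-trans (m≤m⊔n m m′) le) , q n (≤-trans (m≤n⊔m m m′) le)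

eventually-∀∈ : {A : Set} {Q : A → ℕ → Set} (xs : List A) →
  (∀ x → Eventually (Q x)) → Eventually (λ n → ∀ {x} → x ∈ xs → Q x n)
eventually-∀∈ []       ev = 0 , λ _ _ ()
eventually-∀∈ (x ∷ xs) ev with eventually-× (ev x) (eventually-∀∈ xs ev)
... | m , both = m , λ
  { n le (here refl) → proj₁ (both n le)
  ; n le (there x∈xs) → proj₂ (both n le) x∈xs }

eventually-some : {P : ℕ → Set} → Eventually P → Σ ℕ P
eventually-some (m , p) = m , p m ≤-refl

module Classical (em : ExcludedMiddle 0ℓ) where

  dne : {P : Set} → ¬ ¬ P → P
  dne = em⇒dne em

  -- In a family of sets that pairwise meet only inside D, a point outside D
  -- lies in at most one member; so, eventually, members contain points of a
  -- finite list only inside D.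
  eventually-avoids : {A : Set} (D : A → Set) (F : ℕ → A → Set) →
    (∀ i j → i ≢ j → ∀ x → F i x → F j x → D x) →
    (xs : List A) → Eventually (λ n → ∀ {x} → x ∈ xs → F n x → D x)
  eventually-avoids D F disjoint xs = eventually-∀∈ xs leaves
    where
    leaves : ∀ x → Eventually (λ n → F n x → D x)
    leaves x with em {Σ ℕ λ i → F i x × ¬ D x}
    ... | yes (i , x∈Fi , _) = suc i , λ n i<n x∈Fn → disjoint i n (<⇒≢ i<n) x x∈Fi x∈Fn
    ... | no none = 0 , λ n _ x∈Fn → dne (λ ¬Dx → none (n , x∈Fn , ¬Dx))

  collect : {A B : Set} {P : A → Set} {C : List B → A → Set} →
    (∀ {S T a} → S ⊆ T → C S a → C T a) →
    (∀ a → P a → Σ (List B) λ S → C S a) →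
    (xs : List A) → Σ (List B) λ T → ∀ {a} → a ∈ xs → P a → C T a
  collect mono choose [] = [] , λ ()
  collect {P = P} mono choose (a ∷ xs) with collect mono choose xs | em {P a}
  ... | T , serves | no ¬Pa = T , λ
    { (here refl) Pa → ⊥-elim (¬Pa Pa)
    ; (there a∈xs) → serves a∈xs }
  ... | T , serves | yes Pa with choose a Pa
  ...   | S , CSa = S ++ T , λ
    { (here refl) _ → mono (xs⊆xs++ys S T) CSa
    ; (there a∈xs) Pa′ → mono (xs⊆ys++xs T S) (serves a∈xs Pa′) }

  module OnGraph (G : Graph) where
    open Graph G

    _≟_ : DecidableEquality V
    x ≟ y = em

    open import Data.List.Membership.DecPropositional _≟_ using (_∈?_)

    walk-last : ∀ {P a b} → WalkIn G P a b → P b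
    walk-last (stop pb)     = pb
    walk-last (step _ _ w) = walk-last w

    walk-head : ∀ {P a b} → WalkIn G P a b → P a
    walk-head (stop pa)     = pa
    walk-head (step pa _ _) = pa

    infixr 5 _++ʷ_
    _++ʷ_ : ∀ {P a b c} → WalkIn G P a b → WalkIn G P b c → WalkIn G P a c
    stop _       ++ʷ w′ = w′
    step pa e w ++ʷ w′ = step pa e (w ++ʷ w′)

    reverseʷ : ∀ {P a b} → WalkIn G P a b → WalkIn G P b a
    reverseʷ (stop pa)     = stop pa
    reverseʷ (step pa e w) = reverseʷ w ++ʷ step (walk-head w) (~-sym e) (stop pa)

    weakenʷ : ∀ {P Q : V → Set} {a b} → (∀ {x} → P x → Q x) → WalkIn G P a b → WalkIn G Q a b
    weakenʷ f (stop pa)     = stop (f pa)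
    weakenʷ f (step pa e w) = step (f pa) e (weakenʷ f w)

    infixr 5 _++ⁿ_
    _++ⁿ_ : ∀ {n m a b c} → Walk G n a b → Walk G m b c → Walk G (n + m) a c
    stop       ++ⁿ w′ = w′
    step e w ++ⁿ w′ = step e (w ++ⁿ w′)

    ball-shift : ∀ {d b k u y v} → Walk G d u y → d + b ≤ k → InBall G b y v → InBall G k u v
    ball-shift {d} u↝y d+b≤k (n , n≤b , y↝v) =
      d + n , ≤-trans (+-monoʳ-≤ d n≤b) d+b≤k , u↝y ++ⁿ y↝v

    record FirstHit (S : List V) (n : ℕ) (u v : V) : Set where
      constructor hit
      field
        {y}      : V
        {before} : ℕ
        {after}  : ℕ
        y∈S      : y ∈ S
        lengths  : suc before + after ≡ n
        to-y     : Walk G (suc before) u y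
        from-y   : Walk G after y v

    first-hit : ∀ {n u v} S → Walk G n u v → u ∉ S → WalkIn G (Outside G S) u v ⊎ FirstHit S n u v
    first-hit S stop u∉S = inj₁ (stop u∉S)
    first-hit S (step {w = w} e rest) u∉S with w ∈? S
    ... | yes w∈S = inj₂ (hit w∈S refl (step e stop) rest)
    ... | no w∉S with first-hit S rest w∉S
    ...   | inj₁ outside = inj₁ (step u∉S e outside)
    ...   | inj₂ (hit y∈S refl u↝y y↝v) = inj₂ (hit y∈S refl (step e u↝y) y↝v)

    ray-segment : ∀ {P m n} (R : Ray G) → m ≤′ n → (∀ j → m ≤ j → P (seq R j)) →
      WalkIn G P (seq R m) (seq R n)
    ray-segment R ≤′-refl tail = stop (tail _ ≤-refl)
    ray-segment {n = suc n} R (≤′-step m≤′n) tail =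
      ray-segment R m≤′n tail ++ʷ
        step (tail n (≤′⇒≤ m≤′n)) (adj R n) (stop (tail (suc n) (m≤n⇒m≤1+n (≤′⇒≤ m≤′n))))

    ray-eventually-avoids : (R : Ray G) (S : List V) → Eventually (λ n → seq R n ∉ S)
    ray-eventually-avoids R S with eventually-avoids (λ _ → ⊥) (λ n x → seq R n ≡ x) meets-once S
      where
      meets-once : ∀ i j → i ≢ j → ∀ x → seq R i ≡ x → seq R j ≡ x → ⊥
      meets-once i j i≢j x p q = i≢j (inj R (trans p (sym q)))
    ... | m , avoids = m , λ n m≤n n∈S → avoids n m≤n n∈S refl

    tail-lives : ∀ {S} (R : Ray G) m → (∀ n → m ≤ n → seq R n ∉ S) → LivesIn G S (seq R m) R
    tail-lives {S} R m outside = m , λ n m≤n → ray-segment {P = Outside G S} R (≤⇒≤′ m≤n) outside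

    lives-somewhere : (R : Ray G) (S : List V) → Σ V λ c → c ∉ S × LivesIn G S c R
    lives-somewhere R S with ray-eventually-avoids R S
    ... | m , outside = seq R m , outside m ≤-refl , tail-lives R m outside

    ray-refl : (R : Ray G) → RayEquiv G R R
    ray-refl R S with lives-somewhere R S
    ... | c , c∉S , R∈c = c , c∉S , R∈c , R∈c

    same-component : ∀ {S c d} {R : Ray G} → LivesIn G S c R → LivesIn G S d R → InComp G S c d
    same-component (m , c↝) (m′ , d↝) =
      c↝ (m + m′) (m≤m+n m m′) ++ʷ reverseʷ (d↝ (m + m′) (m≤n+m m′ m))

    shrink-lives : ∀ {S T c} {R : Ray G} → S ⊆ T → LivesIn G T c R → LivesIn G S c R
    shrink-lives S⊆T (m , c↝) = m , λ n m≤n → weakenʷ (λ x∉T x∈S → x∉T (S⊆T x∈S)) (c↝ n m≤n)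

    last-∈ : ∀ p {x} → Last G p x → x ∈ p
    last-∈ (y ∷ [])     refl = here refl
    last-∈ (y ∷ z ∷ zs) last = there (last-∈ (z ∷ zs) last)

    -- Paths are non-empty, so prepending a vertex does not change the last vertex.
    last-∷⁻ : ∀ {u w p b} → PathFrom G w p → Last G (u ∷ p) b → Last G p b
    last-∷⁻ one        last = last
    last-∷⁻ (cons _ _) last = last

    last-∷⁺ : ∀ {u w p b} → PathFrom G w p → Last G p b → Last G (u ∷ p) b
    last-∷⁺ one        last = last
    last-∷⁺ (cons _ _) last = last

    path→walk : ∀ {P v p b} → PathFrom G v p → Last G p b → (∀ {x} → x ∈ p → P x) → WalkIn G P v b
    path→walk one         refl inside = stop (inside (here refl))
    path→walk (cons e pf) last inside =
      step (inside (here refl)) e (path→walk pf (last-∷⁻ pf last) (λ x∈p → inside (there x∈p)))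

    suffix-from : ∀ {u w q b} → u ∈ q → PathFrom G w q → Unique q → Last G q b →
      Σ (List V) λ p → PathFrom G u p × Unique p × Last G p b × p ⊆ q
    suffix-from (here refl) one          uq       last = _ , one , uq , last , λ x∈ → x∈
    suffix-from (here refl) (cons e pf)  uq       last = _ , cons e pf , uq , last , λ x∈ → x∈
    suffix-from (there u∈q) (cons _ pf) (_ ∷ uq) last with suffix-from u∈q pf uq (last-∷⁻ pf last)
    ... | p , pf′ , up , last′ , p⊆q = p , pf′ , up , last′ , λ x∈p → there (p⊆q x∈p)

    walk→path : ∀ {P a b} → WalkIn G P a b →
      Σ (List V) λ p → PathFrom G a p × Unique p × Last G p b × (∀ {x} → x ∈ p → P x)
    walk→path (stop pa) = _ , one , [] ∷ [] , refl , λ { (here refl) → pa }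
    walk→path {a = a} (step pa e w) with walk→path w
    ... | q , pf , uq , last , inside with a ∈? q
    ...   | yes a∈q with suffix-from a∈q pf uq last
    ...     | p , pf′ , up , last′ , p⊆q = p , pf′ , up , last′ , λ x∈p → inside (p⊆q x∈p)
    walk→path {a = a} (step pa e w) | q , pf , uq , last , inside | no a∉q =
      a ∷ q , cons e pf , ¬Any⇒All¬ q a∉q ∷ uq , last-∷⁺ pf last ,
      λ { (here refl) → pa ; (there x∈q) → inside x∈q }

    closed-path-trivial : ∀ {v p} → PathFrom G v p → Unique p → Last G p v → p ≡ v ∷ []
    closed-path-trivial one _ _ = refl
    closed-path-trivial (cons _ pf) (v∉rest ∷ _) last =
      ⊥-elim (All¬⇒¬Any v∉rest (last-∈ _ (last-∷⁻ pf last)))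

    Unseparated : V → Ray G → Set
    Unseparated v R = ∀ S → v ∉ S → Σ V λ c → LivesIn G S c R × InComp G S v c

    -- Given S, take two dominating paths avoiding S and the initial segment of
    -- the ray before its tail in the component c; one of them ends off v and
    -- thus leads from v into c.
    dominates⇒unseparated : ∀ {v R} → Dominates G v R → Unseparated v R
    dominates⇒unseparated {v} (R′ , R~R′ , P , to-R′ , distinct , disjoint) S v∉S
      with R~R′ S
    ... | c , _ , R∈c , (m , R′-tail)
      with eventually-avoids (λ x → x ≡ v) (λ n x → x ∈ P n) disjoint (S ++ applyUpTo (seq R′) m)
    ... | a , avoids = c , R∈c , reach
      where
      via : ∀ i → a ≤ i → ∀ {e} → Last G (P i) e → (Σ ℕ λ n → seq R′ n ≡ e) → e ≢ v → InComp G S v c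
      via i a≤i last (n , refl) e≢v =
        path→walk (proj₁ (to-R′ i)) last outside ++ʷ reverseʷ (R′-tail n m≤n)
        where
        at-v : ∀ {x} → x ∈ P i → x ∈ S ++ applyUpTo (seq R′) m → x ≡ v
        at-v x∈Pi x∈ = avoids i a≤i x∈ x∈Pi
        outside : ∀ {x} → x ∈ P i → x ∉ S
        outside x∈Pi x∈S = v∉S (subst (_∈ S) (at-v x∈Pi (∈-++⁺ˡ x∈S)) x∈S)
        m≤n : m ≤ n
        m≤n = ≮⇒≥ λ n<m → e≢v (at-v (last-∈ _ last) (∈-++⁺ʳ S (∈-applyUpTo⁺ (seq R′) n<m)))
      reach : InComp G S v c
      reach with to-R′ a | to-R′ (suc a)
      ... | pf₀ , u₀ , e₀ , last₀ , n₀ | pf₁ , u₁ , e₁ , last₁ , n₁ with e₀ ≟ v | e₁ ≟ v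
      ... | no e₀≢v | _       = via a ≤-refl last₀ n₀ e₀≢v
      ... | yes _   | no e₁≢v = via (suc a) (n≤1+n a) last₁ n₁ e₁≢v
      ... | yes refl | yes refl = ⊥-elim (distinct a (suc a) (<⇒≢ (n<1+n a))
            (trans (closed-path-trivial pf₀ u₀ last₀) (sym (closed-path-trivial pf₁ u₁ last₁))))

    -- Conversely, choose paths from v to R one after another, the next one
    -- avoiding every vertex other than v of the earlier ones.
    module Greedy {v} {R : Ray G} (unseparated : Unseparated v R) where

      GoodPath : List V → List V → Set
      GoodPath S p = PathToRay G v R p × (∀ {x} → x ∈ p → x ∉ S) × Σ V λ e → e ∈ p × e ≢ v

      good-path : ∀ S → v ∉ S → Σ (List V) (GoodPath S)
      good-path S v∉S with unseparated S v∉S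
      ... | c , R∈c , v↝c with eventually-some (eventually-× R∈c (ray-eventually-avoids R [ v ]))
      ...   | n , c↝Rn , Rn∉[v] with walk→path (v↝c ++ʷ c↝Rn)
      ...     | p , pf , up , last , outside =
        p , (pf , up , seq R n , last , n , refl) , outside ,
        seq R n , last-∈ p last , λ eq → Rn∉[v] (here eq)

      forbidden : List (List V) → List V
      forbidden ps = filter (λ x → ¬? (x ≟ v)) (concat ps)

      v∉forbidden : ∀ ps → v ∉ forbidden ps
      v∉forbidden ps v∈ = proj₂ (∈-filter⁻ (λ x → ¬? (x ≟ v)) {xs = concat ps} v∈) refl

      earlier : ℕ → List (List V)
      path : ℕ → List V

      earlier zero    = []
      earlier (suc n) = path n ∷ earlier n

      path n = proj₁ (good-path (forbidden (earlier n)) (v∉forbidden (earlier n)))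

      path-good : ∀ n → GoodPath (forbidden (earlier n)) (path n)
      path-good n = proj₂ (good-path (forbidden (earlier n)) (v∉forbidden (earlier n)))

      earlier-∋ : ∀ {i} n → i < n → path i ∈ earlier n
      earlier-∋ (suc n) i<1+n with m≤n⇒m<n∨m≡n (≤-pred i<1+n)
      ... | inj₁ i<n  = there (earlier-∋ n i<n)
      ... | inj₂ refl = here refl

      meet-at-v< : ∀ {i j x} → i < j → x ∈ path i → x ∈ path j → x ≡ v
      meet-at-v< {j = j} {x = x} i<j x∈i x∈j with x ≟ v
      ... | yes x≡v = x≡v
      ... | no x≢v  = ⊥-elim (proj₁ (proj₂ (path-good j)) x∈j
            (∈-filter⁺ (λ y → ¬? (y ≟ v)) (∈-concat⁺′ x∈i (earlier-∋ j i<j)) x≢v))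

      meet-at-v : ∀ i j → i ≢ j → ∀ x → x ∈ path i → x ∈ path j → x ≡ v
      meet-at-v i j i≢j x x∈i x∈j with <-cmp i j
      ... | tri< i<j _ _ = meet-at-v< i<j x∈i x∈j
      ... | tri≈ _ i≡j _ = ⊥-elim (i≢j i≡j)
      ... | tri> _ _ j<i = meet-at-v< j<i x∈j x∈i

      -- Each path has a vertex other than v, so different paths are distinct.
      distinct : ∀ i j → i ≢ j → path i ≢ path j
      distinct i j i≢j pi≡pj with proj₂ (proj₂ (path-good j))
      ... | e , e∈j , e≢v = e≢v (meet-at-v i j i≢j e (subst (e ∈_) (sym pi≡pj) e∈j) e∈j)

      unseparated⇒dominates : Dominates G v R
      unseparated⇒dominates = R , ray-refl R , path , (λ i → proj₁ (path-good i)) , distinct , meet-at-v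

    separation : ∀ {v} {R : Ray G} → ¬ Dominates G v R →
      Σ (List V) λ S → v ∉ S × ¬ (Σ V λ c → LivesIn G S c R × InComp G S v c)
    separation {v} {R} ¬dom = dne λ ¬sep →
      ¬dom (Greedy.unseparated⇒dominates {v} {R} λ S v∉S → dne λ ¬reach → ¬sep (S , v∉S , ¬reach))

    module Shielding (R : Ray G) where

      Undominated : ℕ → V → Set
      Undominated b u = ∀ v → InBall G b u v → ¬ Dominates G v R

      Shields : List V → ℕ → V → Set
      Shields S b u = ∀ c (R′ : Ray G) → LivesIn G S c R → LivesIn G S c R′ →
        ∀ v → InBall G b u v → ¬ Dominates G v R′

      shields-mono : ∀ {S T b u} → S ⊆ T → Shields S b u → Shields T b u
      shields-mono S⊆T shields c R′ R∈c R′∈c =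
        shields c R′ (shrink-lives {R = R} S⊆T R∈c) (shrink-lives {R = R′} S⊆T R′∈c)

      ShieldExists : ℕ → Set
      ShieldExists b = ∀ u → Undominated b u → Σ (List V) λ S → Shields S b u

      -- Separate u from R by S₀, and add shields of the balls B_b(y), y ∈ S₀, b < k.
      shield-step : ∀ k → (∀ {b} → b < k → ShieldExists b) → ShieldExists k
      shield-step k smaller u undominated with separation {R = R} (undominated u (0 , z≤n , stop))
      ... | S₀ , u∉S₀ , u-cut
        with collect shields-mono (λ { (b , y) (b<k , und) → smaller b<k y und })
                                  (cartesianProduct (upTo k) S₀)
      ... | T , shields-T = S₀ ++ T , shielded
        where
        -- A walk u ↝ v avoiding S₀ would connect u, through a dominator v of R′,
        -- to the component of R; a walk meeting S₀ first at y is covered by T.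
        shielded : Shields (S₀ ++ T) k u
        shielded c R′ R∈c R′∈c v (n , n≤k , u↝v) dom with first-hit S₀ u↝v u∉S₀
        ... | inj₁ u↝v-outside with dominates⇒unseparated {R = R′} dom S₀ (walk-last u↝v-outside)
        ...   | c′ , R′∈c′ , v↝c′ = u-cut (c , shrink-lives {R = R} (xs⊆xs++ys S₀ T) R∈c ,
                  (u↝v-outside ++ʷ v↝c′ ++ʷ
                     same-component {R = R′} R′∈c′ (shrink-lives {R = R′} (xs⊆xs++ys S₀ T) R′∈c)))
        shielded c R′ R∈c R′∈c v (n , n≤k , u↝v) dom | inj₂ (hit {y} {a} {b} y∈S₀ lengths u↝y y↝v) =
          shields-mono (xs⊆ys++xs T S₀)
            (shields-T (∈-cartesianProduct⁺ (∈-upTo⁺ b<k) y∈S₀) (b<k , undominated-y))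
            c R′ R∈c R′∈c v (b , ≤-refl , y↝v) dom
          where
          1+a+b≤k : suc a + b ≤ k
          1+a+b≤k = subst (_≤ k) (sym lengths) n≤k
          b<k : b < k
          b<k = ≤-trans (s≤s (m≤n+m b a)) 1+a+b≤k
          undominated-y : Undominated b y
          undominated-y v′ v′∈B = undominated v′ (ball-shift u↝y 1+a+b≤k v′∈B)

      shield : ∀ k → ShieldExists k
      shield = <-rec ShieldExists shield-step

      shield⇒neighbourhood : ∀ {S k r} → Shields S k r →
        Σ V λ c → c ∉ S × LivesIn G S c R × (∀ R′ → LivesIn G S c R′ → ¬ InΩ G r k R′)
      shield⇒neighbourhood {S} shields with lives-somewhere R S
      ... | c , c∉S , R∈c =
        c , c∉S , R∈c , λ R′ R′∈c (v , v∈B , dom) → shields c R′ R∈c R′∈c v v∈B dom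

lemma4p4 : ExcludedMiddle 0ℓ → (G : Graph) (r : Graph.V G) (k : ℕ) →
    IsClosed G (InΩ G r k)
lemma4p4 em G r k R R∉Ω =
  let open Classical.OnGraph em G
      open Shielding R
      (S , shields) = shield k r (λ v v∈B dom → R∉Ω (v , v∈B , dom))
  in S , shield⇒neighbourhood shields
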